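{- Let $G$ be a finite $\Sigma^\circ$-labeled graph and $Z$ a zone of the zoning of $G$. For any two vertices $u,v\in V_Z$ there is a vertex $x\in V_Z$ with directed paths $x\to^* u$ and $x\to^* v$ using only edges included in $Z$.
   Context: $\Sigma$ is a signature with arities $\#$; $\Sigma^\circ=(\Sigma\uplus\mathbb{N}^+)\uplus\{\bot,\top\}$ is the flat lattice; a $\Sigma^\circ$-labeled graph has vertices and edges labeled in $\Sigma^\circ$, with source and target maps $s,t$. A vertex $v$ is in-well-formed (I) if it has at most one incoming edge; it is out-well-formed (O) if its label $l$ lies in $\Sigma$ and $v$ has precisely $\#(l)$ outgoing edges, labeled $1,2,\ldots,\#(l)$. A vertex is good if it is O and all its children (targets of its outgoing edges) are I; otherwise it is bad. The zoning of $G$ is constructed iteratively: initially each vertex forms its own zone (a subgraph); repeatedly, if an edge $e$ is not included in any zone and $s(e)$ is good, the zones of $s(e)$ and $t(e)$ are joined along $e$ (if they are the same zone $Z$, $e$ is added to $Z$); stop when no such edge remains. -}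

module Defs where

open import Data.Nat using (ℕ; _≤_; s≤s; z≤n; suc)
open import Data.Fin using (Fin; toℕ)
open import Data.Product using (Σ; ∃; _×_; _,_)
open import Data.Sum using (_⊎_)
open import Data.List using (List; []; _∷_)
open import Data.List.Membership.Propositional using (_∈_; _∉_)
open import Relation.Binary.PropositionalEquality using (_≡_)
open import Relation.Binary.Construct.Closure.ReflexiveTransitive using (Star)
open import Relation.Nullary using (¬_)
open import Function.Bundles using (_⤖_; Bijection)

record Signature : Set₁ where
  field
    Sym   : Set
    arity : Sym → ℕ
open Signature public

-- The flat lattice Σ° = (Σ ⊎ ℕ⁺) ⊎ {⊥, ⊤}  (only its carrier is needed here).
data Σ° (Sg : Signature) : Set where
  sym : Sym Sg → Σ° Sg
  nat : (k : ℕ) → 1 ≤ k → Σ° Sg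
  bot : Σ° Sg
  top : Σ° Sg

-- A finite Σ°-labeled graph: vertices Fin n, edges Fin m, source/target maps,
-- vertex and edge labels in Σ°.  (Multigraph; loops allowed.)
record LGraph (Sg : Signature) : Set where
  field
    n m    : ℕ
    s t    : Fin m → Fin n
    vlabel : Fin n → Σ° Sg
    elabel : Fin m → Σ° Sg
open LGraph public

module _ {Sg : Signature} (G : LGraph Sg) where

  Out : Fin (n G) → Set
  Out v = Σ (Fin (m G)) λ e → s G e ≡ v

  InWF : Fin (n G) → Set
  InWF v = ∀ e e' → t G e ≡ v → t G e' ≡ v → e ≡ e'

  -- out-well-formed: label l ∈ Σ and the outgoing edges are precisely #(l)
  -- edges labeled 1, 2, …, #(l)  (a bijection Out v ⤖ Fin #(l) such that the
  -- edge mapped to i carries label i+1)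
  OutWF : Fin (n G) → Set
  OutWF v = Σ (Sym Sg) λ f → (vlabel G v ≡ sym f) ×
    Σ (Out v ⤖ Fin (arity Sg f)) λ φ →
      ∀ (o : Out v) → elabel G (Data.Product.proj₁ o)
                        ≡ nat (suc (toℕ (Bijection.to φ o))) (s≤s z≤n)

  Good : Fin (n G) → Set
  Good v = OutWF v × (∀ e → s G e ≡ v → InWF (t G e))

  -- State of the zoning construction: the list of edges already included in
  -- some zone.  Zones of a state are the subgraphs obtained from the
  -- connected components of the included edges (initially: every vertex is
  -- its own zone; joining the zones of s(e), t(e) along e, or adding e to a
  -- zone, is exactly including e).
  data Step (S : List (Fin (m G))) : List (Fin (m G)) → Set where
    join : ∀ e → e ∉ S → Good (s G e) → Step S (e ∷ S)

  IsZoning : List (Fin (m G)) → Set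
  IsZoning S = Star Step [] S × (∀ e → e ∉ S → ¬ Good (s G e))

  SameZone : List (Fin (m G)) → Fin (n G) → Fin (n G) → Set
  SameZone S = Star λ a b → ∃ λ e → e ∈ S ×
                 ((s G e ≡ a × t G e ≡ b) ⊎ (s G e ≡ b × t G e ≡ a))

  -- the zone Z of representative r: vertices V_Z, edges E_Z
  InZoneV : List (Fin (m G)) → Fin (n G) → Fin (n G) → Set
  InZoneV S r v = SameZone S r v

  InZoneE : List (Fin (m G)) → Fin (n G) → Fin (m G) → Set
  InZoneE S r e = e ∈ S × SameZone S r (s G e)

  ZPath : List (Fin (m G)) → Fin (n G) → Fin (n G) → Fin (n G) → Set
  ZPath S r = Star λ a b → ∃ λ e → InZoneE S r e × s G e ≡ a × t G e ≡ b

{-# OPTIONS --safe #-}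
module Submission where

-- Every edge included by the construction has a good source, so its target is in-well-formed:
-- each vertex has at most one incoming zone edge. Walk along an undirected
-- zone path from u to v while keeping a common ancestor x of u and of the
-- current vertex w. A forward edge w → w' extends the path x →* w. A backward
-- edge w' → w is either the last edge of x →* w (it is the only edge into w),
-- so x reaches w', or x = w, and then w' becomes the new ancestor.

open import Level using (_⊔_)
open import Defs
open import Data.Fin using (Fin)
open import Data.List using (List)
open import Data.List.Membership.Propositional using (_∈_)
open import Data.List.Relation.Unary.All as All using (All; _∷_)
open import Data.Product using (∃; _×_; _,_; proj₂)
open import Data.Sum as Sum using (_⊎_; inj₁; inj₂)
open import Relation.Binary.Core using (Rel)
open import Relation.Binary.PropositionalEquality using (_≡_; refl; cong)
open import Relation.Binary.Construct.Closure.ReflexiveTransitive as Star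
  using (Star; ε; _◅_; _◅◅_)
open import Relation.Binary.Construct.Closure.Symmetric using (SymClosure; fwd; bwd)
open import Relation.Binary.Construct.Closure.Equivalence using (EqClosure)

module CommonAncestor {a ℓ} {A : Set a} (R : Rel A ℓ)
  (predecessor-unique : ∀ {x x′ y} → R x y → R x′ y → x ≡ x′) where

  CommonAncestor : A → A → Set (a ⊔ ℓ)
  CommonAncestor u w = ∃ λ x → Star R x u × Star R x w

  empty-or-snoc : ∀ {x w} → Star R x w → x ≡ w ⊎ ∃ λ y → Star R x y × R y w
  empty-or-snoc ε = inj₁ refl
  empty-or-snoc (xRy ◅ p) with empty-or-snoc p
  ... | inj₁ refl = inj₂ (_ , ε , xRy)
  ... | inj₂ (y , q , yRw) = inj₂ (y , xRy ◅ q , yRw)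

  commonAncestor-step : ∀ {u w w′} → SymClosure R w w′ →
    CommonAncestor u w → CommonAncestor u w′
  commonAncestor-step (fwd wRw′) (x , xu , xw) = x , xu , xw ◅◅ wRw′ ◅ ε
  commonAncestor-step (bwd w′Rw) (x , xu , xw) with empty-or-snoc xw
  ... | inj₁ refl = _ , w′Rw ◅ xu , ε
  ... | inj₂ (y , xy , yRw) rewrite predecessor-unique yRw w′Rw = x , xu , xy

  commonAncestor-transport : ∀ {u w w′} → EqClosure R w w′ →
    CommonAncestor u w → CommonAncestor u w′
  commonAncestor-transport ε anc = anc
  commonAncestor-transport (step ◅ p) anc =
    commonAncestor-transport p (commonAncestor-step step anc)

  commonAncestor : ∀ {u v} → EqClosure R u v → CommonAncestor u v
  commonAncestor uv = commonAncestor-transport uv (_ , ε , ε)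

module _ {Sg : Signature} (G : LGraph Sg) where

  GoodSource : Fin (m G) → Set
  GoodSource e = Good G (s G e)

  Included : List (Fin (m G)) → Rel (Fin (n G)) _
  Included S a b = ∃ λ e → e ∈ S × s G e ≡ a × t G e ≡ b

  sourcesGood-preserved : ∀ {S S′} → Star (Step G) S S′ →
    All GoodSource S → All GoodSource S′
  sourcesGood-preserved ε good = good
  sourcesGood-preserved (join e _ g ◅ steps) good = sourcesGood-preserved steps (g ∷ good)

  included-predecessor-unique : ∀ {S} → All GoodSource S →
    ∀ {a a′ b} → Included S a b → Included S a′ b → a ≡ a′
  included-predecessor-unique good (e , e∈S , refl , refl) (e′ , _ , refl , te′) =
    cong (s G) (proj₂ (All.lookup good e∈S) e refl e e′ refl te′)

  sameZone⇒eqClosure : ∀ {S a b} → SameZone G S a b → EqClosure (Included S) a b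
  sameZone⇒eqClosure = Star.map λ where
    (e , e∈S , inj₁ (sa , tb)) → fwd (e , e∈S , sa , tb)
    (e , e∈S , inj₂ (sb , ta)) → bwd (e , e∈S , sb , ta)

  included-reverse-sameZone : ∀ {S a b} → Star (Included S) a b → SameZone G S b a
  included-reverse-sameZone =
    Star.reverse λ (e , e∈S , sa , tb) → e , e∈S , inj₂ (sa , tb)

  sameZone-sym : ∀ {S a b} → SameZone G S a b → SameZone G S b a
  sameZone-sym = Star.reverse λ (e , e∈S , edge) → e , e∈S , Sum.swap edge

  included⇒zPath : ∀ {S r a b} → SameZone G S r a → Star (Included S) a b → ZPath G S r a b
  included⇒zPath ra ε = ε
  included⇒zPath ra ((e , e∈S , refl , tb) ◅ p) =
    (e , (e∈S , ra) , refl , tb) ◅ included⇒zPath (ra ◅◅ (e , e∈S , inj₁ (refl , tb)) ◅ ε) p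

  included-commonAncestor : ∀ {S u v} → All GoodSource S → SameZone G S u v →
    ∃ λ x → Star (Included S) x u × Star (Included S) x v
  included-commonAncestor good uv = commonAncestor (sameZone⇒eqClosure uv)
    where open CommonAncestor (Included _) (included-predecessor-unique good)

proposition53 : ∀ {Sg : Signature} (G : LGraph Sg) (S : List (Fin (m G))) →
    IsZoning G S → (r u v : Fin (n G)) →
    InZoneV G S r u → InZoneV G S r v →
    ∃ λ x → InZoneV G S r x × ZPath G S r x u × ZPath G S r x v
proposition53 G S (construction , _) r u v ru rv
  with x , xu , xv ← included-commonAncestor G (sourcesGood-preserved G construction All.[])
                                              (sameZone-sym G ru ◅◅ rv)
  = x , rx , included⇒zPath G rx xu , included⇒zPath G rx xv
  where
    rx : SameZone G S r x
    rx = ru ◅◅ included-reverse-sameZone G xu
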